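{- Let $X$ be a $(95,40,12,20)$ strongly regular graph and let $K$ be a $4$-clique of $X$ that is not contained in any $5$-clique of $X$. For $i\in\{0,1,2,3\}$ let $X_i$ be the set of vertices of $V(X)\setminus V(K)$ having exactly $i$ neighbours in $K$, and suppose $(|X_0|,|X_1|,|X_2|,|X_3|)=(1,34,54,2)$. Let $x_0$ be the unique vertex of $X_0$, let $X_3=\{x_1,x_2\}$, and let $X_2^{ -0}$ be the set of vertices of $X_2$ not adjacent to $x_0$. Then at most one vertex of $X_2^{ -0}$ is adjacent to $x_1$, and at most one vertex of $X_2^{ -0}$ is adjacent to $x_2$.
   Context: A $k$-regular graph $G$ on $v$ vertices is a $(v,k,\lambda,\mu)$ strongly regular graph if any two distinct adjacent vertices have exactly $\lambda$ common neighbours and any two distinct non-adjacent vertices have exactly $\mu$ common neighbours. -}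

module Defs where

open import Data.Nat using (ℕ; zero; suc; _+_; _≡ᵇ_)
open import Data.Bool using (Bool; true; false; not; _∧_; if_then_else_)
open import Data.Fin using (Fin; _≟_)
open import Data.List using (List; []; _∷_; length; allFin)
open import Data.Bool.ListAction using (any)
open import Data.List.Relation.Unary.All using (All)
open import Data.List.Relation.Unary.Unique.Propositional using (Unique)
open import Data.List.Membership.Propositional using (_∈_)
open import Data.Product using (_×_)
open import Relation.Binary.PropositionalEquality using (_≡_)
open import Relation.Nullary using (¬_)
open import Relation.Nullary.Decidable using (⌊_⌋)

countL : {A : Set} → (A → Bool) → List A → ℕ
countL p [] = 0
countL p (x ∷ xs) = if p x then suc (countL p xs) else countL p xs

record Graph (n : ℕ) : Set where
  field
    adj    : Fin n → Fin n → Bool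
    sym    : ∀ u v → adj u v ≡ adj v u
    irrefl : ∀ v → adj v v ≡ false
open Graph public

#V : {n : ℕ} → (Fin n → Bool) → ℕ
#V {n} p = countL p (allFin n)

degree : {n : ℕ} → Graph n → Fin n → ℕ
degree G v = #V (λ w → adj G v w)

commonNbrs : {n : ℕ} → Graph n → Fin n → Fin n → ℕ
commonNbrs G u v = #V (λ w → adj G u w ∧ adj G v w)

IsSRG : {v : ℕ} → Graph v → ℕ → ℕ → ℕ → Set
IsSRG G k l m =
  (∀ x → degree G x ≡ k) ×
  (∀ x y → ¬ x ≡ y → adj G x y ≡ true → commonNbrs G x y ≡ l) ×
  (∀ x y → ¬ x ≡ y → adj G x y ≡ false → commonNbrs G x y ≡ m)

IsClique : {n : ℕ} → Graph n → List (Fin n) → Set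
IsClique G C = Unique C × (∀ x y → x ∈ C → y ∈ C → ¬ x ≡ y → adj G x y ≡ true)

IsSClique : {n : ℕ} → Graph n → ℕ → List (Fin n) → Set
IsSClique G s C = IsClique G C × length C ≡ s

_⊆V_ : {n : ℕ} → List (Fin n) → List (Fin n) → Set
C ⊆V D = All (_∈ D) C

inV : {n : ℕ} → List (Fin n) → Fin n → Bool
inV C v = any (λ u → ⌊ u ≟ v ⌋) C

nbrsIn : {n : ℕ} → Graph n → List (Fin n) → Fin n → ℕ
nbrsIn G K v = countL (λ u → adj G v u) K

inX : {n : ℕ} → Graph n → List (Fin n) → ℕ → Fin n → Bool
inX G K i v = not (inV K v) ∧ (nbrsIn G K v ≡ᵇ i)

sizeX : {n : ℕ} → Graph n → List (Fin n) → ℕ → ℕ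
sizeX G K i = #V (inX G K i)

-- Write i(x) for the number of neighbours of x in K and aⱼ(x) for the number of its
-- neighbours in Xⱼ. As K is a maximal 4-clique, the vertex set is partitioned into K, X₀, …, X₃.
-- Counting paths x – w – k with k ∈ K in two ways (λ = 12, μ = 20 at each k) and comparing
-- with the degree 40 gives, for every x outside K,
--   a₂(x) + 2 a₃(x) + 10 i(x) = 40 + a₀(x).
-- At x₀ (where i = a₀ = 0) this forces a₁(x₀) = a₃(x₀) = [x₀~x₁] + [x₀~x₂]; at x = x₁ it gives
-- a₂(x) = 10 + [x~x₀] − 2 [x~x₂]. The 20 − 8 [x₀~x] common neighbours of x₀ and x lie in
-- X₁ ∪ X₂ ∪ X₃ (x₀ has no neighbour in K and is alone in X₀), so at least
-- 20 − 9 [x₀~x] − [x₀~x₂] − [x₀~x₂][x~x₂] of them lie in X₂; what remains of a₂(x) is at most 1.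

module Submission where

open import Defs hiding (sym)
open import Data.Nat using (ℕ; zero; suc; _+_; _*_; _≤_; _<_; z≤n; s≤s; _≡ᵇ_)
open import Data.Nat.Properties hiding (_≟_)
open import Data.Nat.ListAction using (sum)
open import Data.Nat.Tactic.RingSolver using (solve-∀)
open import Algebra.Properties.Semiring.Sum +-*-semiring
  using (sum-syntax; ∑-distrib-+; sum-cong-≗; *-distribˡ-sum; sum-replicate-zero)
open import Data.Bool using (Bool; true; false; not; _∧_; _∨_; T)
open import Data.Bool.Properties using (∧-zeroʳ)
open import Data.Fin using (Fin; zero; suc; _≟_)
open import Data.List using (List; []; _∷_; length; map; tabulate)
open import Data.List.Membership.Propositional using (_∈_; _∉_)
open import Data.List.Relation.Unary.Any using (here; there)
open import Data.List.Relation.Unary.All as All using (All; []; _∷_)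
open import Data.List.Relation.Unary.All.Properties using (All¬⇒¬Any; ¬Any⇒All¬)
open import Data.List.Relation.Unary.AllPairs using ([]; _∷_)
open import Data.List.Relation.Unary.Unique.Propositional using (Unique)
open import Data.Product using (_×_; _,_; proj₁; proj₂)
open import Function using (_∘_)
open import Relation.Binary.PropositionalEquality
open import Relation.Nullary using (¬_; yes; no; contradiction)
open import Relation.Nullary.Decidable using (⌊_⌋)

χ : Bool → ℕ
χ true = 1
χ false = 0

χ≤1 : ∀ b → χ b ≤ 1
χ≤1 true = s≤s z≤n
χ≤1 false = z≤n

χ-∧-≤ʳ : ∀ a b → χ (a ∧ b) ≤ χ b
χ-∧-≤ʳ true b = ≤-refl
χ-∧-≤ʳ false b = z≤n

χ-∧-split : ∀ a b c → χ (a ∧ b) ≡ χ (a ∧ (not c ∧ b)) + χ (a ∧ (c ∧ b))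
χ-∧-split false b c = refl
χ-∧-split true b false = sym (+-identityʳ (χ b))
χ-∧-split true b true = refl

χ-cases : ∀ c b → χ b ≡ χ (c ∧ b) + χ (not c ∧ b)
χ-cases true b = sym (+-identityʳ (χ b))
χ-cases false b = refl

χ*χ≡χ-∧ : ∀ a b → χ a * χ b ≡ χ (a ∧ b)
χ*χ≡χ-∧ false b = refl
χ*χ≡χ-∧ true b = +-identityʳ (χ b)

sum-mono-≤ : ∀ {n} {f g : Fin n → ℕ} → (∀ i → f i ≤ g i) → ∑[ i < n ] f i ≤ ∑[ i < n ] g i
sum-mono-≤ {zero} f≤g = z≤n
sum-mono-≤ {suc n} f≤g = +-mono-≤ (f≤g zero) (sum-mono-≤ (f≤g ∘ suc))

∑≡0⇒≡0 : ∀ {n} (f : Fin n → ℕ) → ∑[ i < n ] f i ≡ 0 → ∀ i → f i ≡ 0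
∑≡0⇒≡0 f ∑f≡0 zero = m+n≡0⇒m≡0 (f zero) ∑f≡0
∑≡0⇒≡0 f ∑f≡0 (suc i) = ∑≡0⇒≡0 (f ∘ suc) (m+n≡0⇒n≡0 (f zero) ∑f≡0) i

countL-tabulate : ∀ {A : Set} {n} (p : A → Bool) (f : Fin n → A) →
  countL p (tabulate f) ≡ ∑[ i < n ] χ (p (f i))
countL-tabulate {n = zero} p f = refl
countL-tabulate {n = suc n} p f with p (f zero)
... | true = cong suc (countL-tabulate p (f ∘ suc))
... | false = countL-tabulate p (f ∘ suc)

#V≡∑ : ∀ {n} (p : Fin n → Bool) → #V p ≡ ∑[ w < n ] χ (p w)
#V≡∑ p = countL-tabulate p (λ w → w)

∑-χ-≟ : ∀ {n} (a : Fin n) (g : Fin n → Bool) → ∑[ w < n ] χ (⌊ a ≟ w ⌋ ∧ g w) ≡ χ (g a)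
∑-χ-≟ {suc n} zero g with g zero
... | true = cong suc (sum-replicate-zero n)
... | false = sum-replicate-zero n
∑-χ-≟ {suc n} (suc a) g =
  trans (sum-cong-≗ (λ w → cong (λ b → χ (b ∧ g (suc w))) (⌊suc≟suc⌋ a w))) (∑-χ-≟ a (g ∘ suc))
  where
    ⌊suc≟suc⌋ : ∀ {n} (a w : Fin n) → ⌊ Fin.suc a ≟ suc w ⌋ ≡ ⌊ a ≟ w ⌋
    ⌊suc≟suc⌋ a w with a ≟ w
    ... | yes _ = refl
    ... | no _ = refl

∑-+ : ∀ {n} (f : Fin n → ℕ) {g : Fin n → ℕ} {a b} →
  ∑[ i < n ] f i ≡ a → ∑[ i < n ] g i ≡ b → ∑[ i < n ] (f i + g i) ≡ a + b
∑-+ f {g} ∑f ∑g = trans (∑-distrib-+ f g) (cong₂ _+_ ∑f ∑g)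

∑-* : ∀ {n} c (f : Fin n → ℕ) {a} → ∑[ i < n ] f i ≡ a → ∑[ i < n ] (c * f i) ≡ c * a
∑-* c f ∑f = trans (sym (*-distribˡ-sum c f)) (cong (c *_) ∑f)

countL-∷ : ∀ {A : Set} (p : A → Bool) x xs → countL p (x ∷ xs) ≡ χ (p x) + countL p xs
countL-∷ p x xs with p x
... | true = refl
... | false = refl

countL-singleton : ∀ {A : Set} (p : A → Bool) x → countL p (x ∷ []) ≡ χ (p x)
countL-singleton p x with p x
... | true = refl
... | false = refl

countL-pair : ∀ {A : Set} (p : A → Bool) x y → countL p (x ∷ y ∷ []) ≡ χ (p x) + χ (p y)
countL-pair p x y = trans (countL-∷ p x (y ∷ [])) (cong (χ (p x) +_) (countL-singleton p y))

countL≤length : ∀ {A : Set} (p : A → Bool) xs → countL p xs ≤ length xs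
countL≤length p [] = z≤n
countL≤length p (x ∷ xs) with p x
... | true = s≤s (countL≤length p xs)
... | false = m≤n⇒m≤1+n (countL≤length p xs)

countL≡length⇒All : ∀ {A : Set} (p : A → Bool) xs → countL p xs ≡ length xs → All (λ x → p x ≡ true) xs
countL≡length⇒All p [] _ = []
countL≡length⇒All p (x ∷ xs) eq with p x in px
... | true = px ∷ countL≡length⇒All p xs (suc-injective eq)
... | false = contradiction (subst (_≤ length xs) eq (countL≤length p xs)) (n≮n (length xs))

All⇒countL≡length : ∀ {A : Set} (p : A → Bool) {xs} → All (λ x → p x ≡ true) xs → countL p xs ≡ length xs
All⇒countL≡length p [] = refl
All⇒countL≡length p {x ∷ xs} (px ∷ pxs) rewrite px = cong suc (All⇒countL≡length p pxs)

countL≡0⇒All : ∀ {A : Set} (p : A → Bool) xs → countL p xs ≡ 0 → All (λ x → p x ≡ false) xs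
countL≡0⇒All p [] _ = []
countL≡0⇒All p (x ∷ xs) eq with p x in px
... | false = px ∷ countL≡0⇒All p xs eq

inV⇒∈ : ∀ {n} (L : List (Fin n)) {w} → inV L w ≡ true → w ∈ L
inV⇒∈ (u ∷ L) {w} e with u ≟ w
... | yes refl = here refl
... | no _ = there (inV⇒∈ L e)

∈⇒inV : ∀ {n} {L : List (Fin n)} {w} → w ∈ L → inV L w ≡ true
∈⇒inV {L = u ∷ L} {w} w∈L with u ≟ w
... | yes _ = refl
∈⇒inV {L = u ∷ L} {w} (here refl) | no u≢w = contradiction refl u≢w
∈⇒inV {L = u ∷ L} {w} (there w∈L) | no _ = ∈⇒inV w∈L

inV≡false⇒∉ : ∀ {n} (L : List (Fin n)) {w} → inV L w ≡ false → w ∉ L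
inV≡false⇒∉ L w∉L w∈L with trans (sym (∈⇒inV w∈L)) w∉L
... | ()

∉⇒inV≡false : ∀ {n} (L : List (Fin n)) {w} → w ∉ L → inV L w ≡ false
∉⇒inV≡false L {w} w∉L with inV L w in e
... | true = contradiction (inV⇒∈ L e) w∉L
... | false = refl

∑-χ-inV : ∀ {n} {L : List (Fin n)} → Unique L → (g : Fin n → Bool) →
  ∑[ w < n ] χ (inV L w ∧ g w) ≡ countL g L
∑-χ-inV {n} {[]} _ g = sum-replicate-zero n
∑-χ-inV {n} {x ∷ L} (x∉L ∷ uL) g = begin
  ∑[ w < n ] χ ((⌊ x ≟ w ⌋ ∨ inV L w) ∧ g w)                    ≡⟨ sum-cong-≗ split ⟩
  ∑[ w < n ] (χ (⌊ x ≟ w ⌋ ∧ g w) + χ (inV L w ∧ g w))          ≡⟨ ∑-distrib-+ (λ w → χ (⌊ x ≟ w ⌋ ∧ g w)) (λ w → χ (inV L w ∧ g w)) ⟩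
  ∑[ w < n ] χ (⌊ x ≟ w ⌋ ∧ g w) + ∑[ w < n ] χ (inV L w ∧ g w) ≡⟨ cong₂ _+_ (∑-χ-≟ x g) (∑-χ-inV uL g) ⟩
  χ (g x) + countL g L                                          ≡⟨ countL-∷ g x L ⟨
  countL g (x ∷ L)                                              ∎
  where
    open ≡-Reasoning
    split : ∀ w → χ ((⌊ x ≟ w ⌋ ∨ inV L w) ∧ g w) ≡ χ (⌊ x ≟ w ⌋ ∧ g w) + χ (inV L w ∧ g w)
    split w with x ≟ w
    ... | yes refl rewrite ∉⇒inV≡false L (All¬⇒¬Any x∉L) = sym (+-identityʳ _)
    ... | no _ = refl

∑-χ-≗inV : ∀ {n} (p : Fin n → Bool) {L : List (Fin n)} → Unique L → (∀ w → p w ≡ inV L w) →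
  (g : Fin n → Bool) → ∑[ w < n ] χ (p w ∧ g w) ≡ countL g L
∑-χ-≗inV p uL p≗L g = trans (sum-cong-≗ (λ w → cong (λ b → χ (b ∧ g w)) (p≗L w))) (∑-χ-inV uL g)

#V≡length⇒≗inV : ∀ {n} (p : Fin n → Bool) {L : List (Fin n)} → Unique L →
  All (λ w → p w ≡ true) L → #V p ≡ length L → ∀ w → p w ≡ inV L w
#V≡length⇒≗inV {n} p {L} uL pL #p w with inV L w in e
... | true = All.lookup pL (inV⇒∈ L e)
... | false = χ≡0 (p w) (trans (cong (λ c → χ (not c ∧ p w)) (sym e)) (∑≡0⇒≡0 outside outside-empty w))
  where
    outside : Fin n → ℕ
    outside v = χ (not (inV L v) ∧ p v)
    total : countL p L + ∑[ v < n ] outside v ≡ countL p L + 0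
    total = begin
      countL p L + ∑[ v < n ] outside v                          ≡⟨ cong (_+ ∑[ v < n ] outside v) (∑-χ-inV uL p) ⟨
      ∑[ v < n ] χ (inV L v ∧ p v) + ∑[ v < n ] outside v       ≡⟨ ∑-distrib-+ (λ v → χ (inV L v ∧ p v)) outside ⟨
      ∑[ v < n ] (χ (inV L v ∧ p v) + outside v)                ≡⟨ sum-cong-≗ (λ v → χ-cases (inV L v) (p v)) ⟨
      ∑[ v < n ] χ (p v)                                        ≡⟨ #V≡∑ p ⟨
      #V p                                                      ≡⟨ #p ⟩
      length L                                                  ≡⟨ All⇒countL≡length p pL ⟨
      countL p L                                                ≡⟨ +-identityʳ _ ⟨
      countL p L + 0                                            ∎
      where open ≡-Reasoning
    outside-empty : ∑[ v < n ] outside v ≡ 0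
    outside-empty = +-cancelˡ-≡ (countL p L) (∑[ v < n ] outside v) 0 total
    χ≡0 : ∀ b → χ b ≡ 0 → b ≡ false
    χ≡0 false _ = refl

module _ {n : ℕ} (G : Graph n) where

  χ-nbr : (Fin n → Bool) → Fin n → Fin n → ℕ
  χ-nbr q x w = χ (q w ∧ adj G x w)

  nbrsWith : (Fin n → Bool) → Fin n → ℕ
  nbrsWith q x = ∑[ w < n ] χ-nbr q x w

  ∑-adj*nbrsIn : ∀ x K → ∑[ w < n ] (χ (adj G x w) * nbrsIn G K w) ≡ sum (map (commonNbrs G x) K)
  ∑-adj*nbrsIn x [] = trans (sum-cong-≗ (λ w → *-zeroʳ (χ (adj G x w)))) (sum-replicate-zero n)
  ∑-adj*nbrsIn x (k ∷ K) = begin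
    ∑[ w < n ] (χ (adj G x w) * nbrsIn G (k ∷ K) w)
      ≡⟨ sum-cong-≗ step ⟩
    ∑[ w < n ] (χ (adj G x w ∧ adj G k w) + χ (adj G x w) * nbrsIn G K w)
      ≡⟨ ∑-distrib-+ (λ w → χ (adj G x w ∧ adj G k w)) (λ w → χ (adj G x w) * nbrsIn G K w) ⟩
    ∑[ w < n ] χ (adj G x w ∧ adj G k w) + ∑[ w < n ] (χ (adj G x w) * nbrsIn G K w)
      ≡⟨ cong₂ _+_ (sym (#V≡∑ (λ w → adj G x w ∧ adj G k w))) (∑-adj*nbrsIn x K) ⟩
    commonNbrs G x k + sum (map (commonNbrs G x) K) ∎
    where
      open ≡-Reasoning
      step : ∀ w → χ (adj G x w) * nbrsIn G (k ∷ K) w ≡ χ (adj G x w ∧ adj G k w) + χ (adj G x w) * nbrsIn G K w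
      step w = begin
        a * nbrsIn G (k ∷ K) w         ≡⟨ cong (a *_) (countL-∷ (adj G w) k K) ⟩
        a * (χ (adj G w k) + r)        ≡⟨ *-distribˡ-+ a (χ (adj G w k)) r ⟩
        a * χ (adj G w k) + a * r      ≡⟨ cong (_+ a * r) (χ*χ≡χ-∧ (adj G x w) (adj G w k)) ⟩
        χ (adj G x w ∧ adj G w k) + a * r ≡⟨ cong (λ b → χ (adj G x w ∧ b) + a * r) (Graph.sym G w k) ⟩
        χ (adj G x w ∧ adj G k w) + a * r ∎
        where
          a = χ (adj G x w)
          r = nbrsIn G K w

  module _ {k l m d : ℕ} (srg : IsSRG G k l m) (l+d≡m : l + d ≡ m) where

    srg-commonNbrs : ∀ {x y} → x ≢ y → commonNbrs G x y + d * χ (adj G x y) ≡ m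
    srg-commonNbrs {x} {y} x≢y with adj G x y in e
    ... | true rewrite proj₁ (proj₂ srg) x y x≢y e = trans (cong (l +_) (*-identityʳ d)) l+d≡m
    ... | false rewrite proj₂ (proj₂ srg) x y x≢y e = trans (cong (m +_) (*-zeroʳ d)) (+-identityʳ m)

    srg-sum-commonNbrs : ∀ {x} K → All (x ≢_) K → sum (map (commonNbrs G x) K) + d * nbrsIn G K x ≡ m * length K
    srg-sum-commonNbrs [] [] = trans (*-zeroʳ d) (sym (*-zeroʳ m))
    srg-sum-commonNbrs {x} (y ∷ K) (x≢y ∷ x∉K) = begin
      (commonNbrs G x y + s) + d * nbrsIn G (y ∷ K) x       ≡⟨ cong (λ t → (commonNbrs G x y + s) + d * t) (countL-∷ (adj G x) y K) ⟩
      (commonNbrs G x y + s) + d * (χ (adj G x y) + c)      ≡⟨ regroup (commonNbrs G x y) s d (χ (adj G x y)) c ⟩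
      (commonNbrs G x y + d * χ (adj G x y)) + (s + d * c)  ≡⟨ cong₂ _+_ (srg-commonNbrs x≢y) (srg-sum-commonNbrs K x∉K) ⟩
      m + m * length K                                      ≡⟨ *-suc m (length K) ⟨
      m * length (y ∷ K)                                    ∎
      where
        open ≡-Reasoning
        s = sum (map (commonNbrs G x) K)
        c = nbrsIn G K x
        regroup : ∀ a s d b c → (a + s) + d * (b + c) ≡ (a + d * b) + (s + d * c)
        regroup = solve-∀

  nbrsWith-split : ∀ (q h : Fin n → Bool) z → nbrsWith q z ≡
    ∑[ w < n ] χ (q w ∧ (not (h w) ∧ adj G z w)) + ∑[ w < n ] χ (q w ∧ (h w ∧ adj G z w))
  nbrsWith-split q h z = trans (sum-cong-≗ (λ w → χ-∧-split (q w) (adj G z w) (h w)))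
    (∑-distrib-+ (λ w → χ (q w ∧ (not (h w) ∧ adj G z w))) (λ w → χ (q w ∧ (h w ∧ adj G z w))))

  clique-nbrsIn : ∀ {K} → IsClique G K → ∀ {w} → w ∈ K → suc (nbrsIn G K w) ≡ length K
  clique-nbrsIn {k ∷ K} ((k∉K ∷ uK) , cl) (here refl)
    rewrite Graph.irrefl G k =
      cong suc (All⇒countL≡length (adj G k) (All.tabulate adj-k))
    where
      adj-k : ∀ {y} → y ∈ K → adj G k y ≡ true
      adj-k y∈K = cl _ _ (here refl) (there y∈K) (All.lookup k∉K y∈K)
  clique-nbrsIn {k ∷ K} ((k∉K ∷ uK) , cl) {w} (there w∈K)
    rewrite cl w k (there w∈K) (here refl) (λ w≡k → All.lookup k∉K w∈K (sym w≡k)) =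
      cong suc (clique-nbrsIn (uK , λ x y x∈K y∈K → cl x y (there x∈K) (there y∈K)) w∈K)

  clique-extend : ∀ {K w} → IsClique G K → w ∉ K → All (λ k → adj G w k ≡ true) K → IsClique G (w ∷ K)
  clique-extend {K} {w} (uK , cl) w∉K w~K = (¬Any⇒All¬ K w∉K ∷ uK) , cl′
    where
      cl′ : ∀ x y → x ∈ w ∷ K → y ∈ w ∷ K → x ≢ y → adj G x y ≡ true
      cl′ x y (here refl) (here refl) x≢y = contradiction refl x≢y
      cl′ x y (here refl) (there y∈K) _ = All.lookup w~K y∈K
      cl′ x y (there x∈K) (here refl) _ = trans (Graph.sym G x w) (All.lookup w~K x∈K)
      cl′ x y (there x∈K) (there y∈K) x≢y = cl x y x∈K y∈K x≢y

  maximal-clique-nbrsIn : ∀ {s K} → IsSClique G s K → (∀ D → IsSClique G (suc s) D → ¬ K ⊆V D) →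
    ∀ {w} → w ∉ K → nbrsIn G K w < s
  maximal-clique-nbrsIn {s} {K} (clK , refl) maximal {w} w∉K = ≤∧≢⇒< (countL≤length (adj G w) K) all-adjacent
    where
      all-adjacent : nbrsIn G K w ≢ length K
      all-adjacent eq = maximal (w ∷ K) (clique-extend clK w∉K (countL≡length⇒All (adj G w) K eq) , refl) (All.tabulate there)

  inX⇒∉×nbrsIn : ∀ K j w → inX G K j w ≡ true → inV K w ≡ false × nbrsIn G K w ≡ j
  inX⇒∉×nbrsIn K j w e with inV K w | nbrsIn G K w ≡ᵇ j in i≡j
  ... | false | true = refl , ≡ᵇ⇒≡ (nbrsIn G K w) j (subst T (sym i≡j) _)

profile-arith : ∀ i a₀ a₁ a₂ a₃ → i + (a₀ + (a₁ + (a₂ + a₃))) ≡ 40 →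
  (3 * i + (a₁ + (2 * a₂ + 3 * a₃))) + 8 * i ≡ 80 → a₂ + 2 * a₃ + 10 * i ≡ 40 + a₀
profile-arith i a₀ a₁ a₂ a₃ deg weighted = +-cancelʳ-≡ D (a₂ + 2 * a₃ + 10 * i) (40 + a₀) (begin
    (a₂ + 2 * a₃ + 10 * i) + D                           ≡⟨ regroupˡ i a₀ a₁ a₂ a₃ ⟩
    ((3 * i + (a₁ + (2 * a₂ + 3 * a₃))) + 8 * i) + a₀    ≡⟨ cong (_+ a₀) {y = 80} weighted ⟩
    80 + a₀                                              ≡⟨ regroupʳ a₀ ⟩
    (40 + a₀) + 40                                       ≡⟨ cong ((40 + a₀) +_) deg ⟨
    (40 + a₀) + D                                        ∎)
  where
    open ≡-Reasoning
    D = i + (a₀ + (a₁ + (a₂ + a₃)))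
    regroupˡ : ∀ i a₀ a₁ a₂ a₃ → (a₂ + 2 * a₃ + 10 * i) + (i + (a₀ + (a₁ + (a₂ + a₃)))) ≡
                                 ((3 * i + (a₁ + (2 * a₂ + 3 * a₃))) + 8 * i) + a₀
    regroupˡ = solve-∀
    regroupʳ : ∀ a₀ → 80 + a₀ ≡ (40 + a₀) + 40
    regroupʳ = solve-∀

a₁≡a₃-arith : ∀ {i a₀ a₁ a₂ a₃} → i ≡ 0 → a₀ ≡ 0 →
  a₂ + 2 * a₃ + 10 * i ≡ 40 + a₀ → i + (a₀ + (a₁ + (a₂ + a₃))) ≡ 40 → a₁ ≡ a₃
a₁≡a₃-arith {a₁ = a₁} {a₂} {a₃} refl refl profile degree =
  +-cancelʳ-≡ (a₂ + a₃) a₁ a₃ (trans degree (trans (sym profile) (regroup a₂ a₃)))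
  where
    regroup : ∀ a₂ a₃ → a₂ + 2 * a₃ + 0 ≡ a₃ + (a₂ + a₃)
    regroup = solve-∀

c≤1-arith : ∀ {c z₂ A B C BC comm} → c + z₂ + 2 * C + 30 ≡ 40 + A → comm + 8 * A ≡ 20 →
  comm ≤ (A + B) + (z₂ + BC) → A ≤ 1 → B ≤ 1 → BC ≤ C → c ≤ 1
c≤1-arith {c} {z₂} {A} {B} {C} {BC} {comm} profile common bound A≤1 B≤1 BC≤C =
  ≤-trans (m≤m+n c C) (+-cancelʳ-≤ (C + 50) (c + C) 1 (+-cancelʳ-≤ z₂ _ _ (begin
    (c + C) + (C + 50) + z₂                      ≡⟨ regroupˡ c z₂ C ⟩
    (c + z₂ + 2 * C + 30) + 20                   ≡⟨ cong₂ _+_ profile (sym common) ⟩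
    (40 + A) + (comm + 8 * A)                    ≤⟨ +-monoʳ-≤ (40 + A) (+-monoˡ-≤ (8 * A) bound) ⟩
    (40 + A) + ((A + B) + (z₂ + BC) + 8 * A)     ≡⟨ regroupᵐ A B z₂ BC ⟩
    40 + 10 * A + B + BC + z₂
      ≤⟨ +-monoˡ-≤ z₂ (+-mono-≤ (+-mono-≤ (+-monoʳ-≤ 40 (*-monoʳ-≤ 10 A≤1)) B≤1) BC≤C) ⟩
    40 + 10 * 1 + 1 + C + z₂                     ≡⟨ regroupʳ C z₂ ⟩
    1 + (C + 50) + z₂                            ∎)))
  where
    open ≤-Reasoning
    regroupˡ : ∀ c z₂ C → (c + C) + (C + 50) + z₂ ≡ (c + z₂ + 2 * C + 30) + 20
    regroupˡ = solve-∀
    regroupᵐ : ∀ A B z₂ BC → (40 + A) + ((A + B) + (z₂ + BC) + 8 * A) ≡ 40 + 10 * A + B + BC + z₂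
    regroupᵐ = solve-∀
    regroupʳ : ∀ C z₂ → 40 + 10 * 1 + 1 + C + z₂ ≡ 1 + (C + 50) + z₂
    regroupʳ = solve-∀

module FourClique {n : ℕ} (G : Graph n) (srg : IsSRG G 40 12 20)
  {K : List (Fin n)} (K-clique : IsSClique G 4 K) (K-maximal : ∀ D → IsSClique G 5 D → ¬ K ⊆V D) where

  X : ℕ → Fin n → Bool
  X = inX G K

  a : ℕ → Fin n → ℕ
  a j = nbrsWith G (X j)

  inK⇒nbrsIn≡3 : ∀ {w} → inV K w ≡ true → nbrsIn G K w ≡ 3
  inK⇒nbrsIn≡3 w∈K = suc-injective (trans (clique-nbrsIn G (proj₁ K-clique) (inV⇒∈ K w∈K)) (proj₂ K-clique))

  ∉K⇒nbrsIn≤3 : ∀ {w} → inV K w ≡ false → nbrsIn G K w ≤ 3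
  ∉K⇒nbrsIn≤3 w∉K = ≤-pred (maximal-clique-nbrsIn G K-clique K-maximal (inV≡false⇒∉ K w∉K))

  χ-adj-partition : ∀ x w → χ (adj G x w) ≡
    χ (inV K w ∧ adj G x w) + (χ (X 0 w ∧ adj G x w) + (χ (X 1 w ∧ adj G x w) + (χ (X 2 w ∧ adj G x w) + χ (X 3 w ∧ adj G x w))))
  χ-adj-partition x w with inV K w in w∈?K
  ... | true = sym (+-identityʳ _)
  ... | false with nbrsIn G K w | ∉K⇒nbrsIn≤3 w∈?K
  ...   | 0 | _ = sym (+-identityʳ _)
  ...   | 1 | _ = sym (+-identityʳ _)
  ...   | 2 | _ = sym (+-identityʳ _)
  ...   | 3 | _ = refl
  ...   | suc (suc (suc (suc _))) | s≤s (s≤s (s≤s ()))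

  χ-adj*nbrsIn-partition : ∀ x w → χ (adj G x w) * nbrsIn G K w ≡
    3 * χ (inV K w ∧ adj G x w) + (χ (X 1 w ∧ adj G x w) + (2 * χ (X 2 w ∧ adj G x w) + 3 * χ (X 3 w ∧ adj G x w)))
  χ-adj*nbrsIn-partition x w with inV K w in w∈?K
  ... | true rewrite inK⇒nbrsIn≡3 w∈?K = trans (*-comm (χ (adj G x w)) 3) (sym (+-identityʳ _))
  ... | false with nbrsIn G K w | ∉K⇒nbrsIn≤3 w∈?K | adj G x w
  ...   | 0 | _ | b = *-zeroʳ (χ b)
  ...   | 1 | _ | b = trans (*-identityʳ (χ b)) (sym (+-identityʳ _))
  ...   | 2 | _ | b = trans (*-comm (χ b) 2) (sym (+-identityʳ _))
  ...   | 3 | _ | b = *-comm (χ b) 3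
  ...   | suc (suc (suc (suc _))) | s≤s (s≤s (s≤s ())) | _

  χ-≤-X₁+X₂+X₃ : ∀ {w} → inV K w ≡ false → X 0 w ≡ false →
    ∀ b → χ b ≤ χ (X 1 w ∧ b) + (χ (X 2 w ∧ b) + χ (X 3 w ∧ b))
  χ-≤-X₁+X₂+X₃ {w} w∉K w∉X₀ b with ∉K⇒nbrsIn≤3 w∉K
  ... | i≤3 with inV K w | w∉K | nbrsIn G K w | w∉X₀ | i≤3
  ...   | .false | refl | 0 | () | _
  ...   | .false | refl | 1 | _ | _ = m≤m+n (χ b) 0
  ...   | .false | refl | 2 | _ | _ = m≤m+n (χ b) 0
  ...   | .false | refl | 3 | _ | _ = ≤-refl
  ...   | .false | refl | suc (suc (suc (suc _))) | _ | s≤s (s≤s (s≤s ()))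

  nbrsWith-K : ∀ x → nbrsWith G (inV K) x ≡ nbrsIn G K x
  nbrsWith-K x = ∑-χ-inV (proj₁ (proj₁ K-clique)) (adj G x)

  ∑-adj-profile : ∀ x → ∑[ w < n ] χ (adj G x w) ≡ nbrsIn G K x + (a 0 x + (a 1 x + (a 2 x + a 3 x)))
  ∑-adj-profile x = trans (sum-cong-≗ (χ-adj-partition x))
    (∑-+ (χ-nbr G (inV K) x) (nbrsWith-K x)
      (∑-+ (χ-nbr G (X 0) x) refl (∑-+ (χ-nbr G (X 1) x) refl (∑-+ (χ-nbr G (X 2) x) refl refl))))

  degree-profile : ∀ x → nbrsIn G K x + (a 0 x + (a 1 x + (a 2 x + a 3 x))) ≡ 40
  degree-profile x = trans (sym (∑-adj-profile x)) (trans (sym (#V≡∑ (adj G x))) (proj₁ srg x))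

  ∑-adj*nbrsIn-profile : ∀ x → ∑[ w < n ] (χ (adj G x w) * nbrsIn G K w) ≡ 3 * nbrsIn G K x + (a 1 x + (2 * a 2 x + 3 * a 3 x))
  ∑-adj*nbrsIn-profile x = trans (sum-cong-≗ (χ-adj*nbrsIn-partition x))
    (∑-+ (λ w → 3 * χ-nbr G (inV K) x w) (∑-* 3 (χ-nbr G (inV K) x) (nbrsWith-K x))
      (∑-+ (χ-nbr G (X 1) x) refl
        (∑-+ (λ w → 2 * χ-nbr G (X 2) x w) (∑-* 2 (χ-nbr G (X 2) x) refl) (∑-* 3 (χ-nbr G (X 3) x) refl))))

  profile : ∀ {x} → inV K x ≡ false → a 2 x + 2 * a 3 x + 10 * nbrsIn G K x ≡ 40 + a 0 x
  profile {x} x∉K = profile-arith (nbrsIn G K x) (a 0 x) (a 1 x) (a 2 x) (a 3 x) (degree-profile x) (begin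
    (3 * nbrsIn G K x + (a 1 x + (2 * a 2 x + 3 * a 3 x))) + 8 * nbrsIn G K x  ≡⟨ cong (_+ 8 * nbrsIn G K x) (∑-adj*nbrsIn-profile x) ⟨
    ∑[ w < n ] (χ (adj G x w) * nbrsIn G K w) + 8 * nbrsIn G K x               ≡⟨ cong (_+ 8 * nbrsIn G K x) (∑-adj*nbrsIn G x K) ⟩
    sum (map (commonNbrs G x) K) + 8 * nbrsIn G K x                            ≡⟨ srg-sum-commonNbrs G srg refl K x≢K ⟩
    20 * length K                                                              ≡⟨ cong (20 *_) (proj₂ K-clique) ⟩
    80                                                                         ∎)
    where
      open ≡-Reasoning
      x≢K : All (x ≢_) K
      x≢K = ¬Any⇒All¬ K (inV≡false⇒∉ K x∉K)

  module _ (|X₀|≡1 : sizeX G K 0 ≡ 1) (|X₃|≡2 : sizeX G K 3 ≡ 2) {x₀ x y : Fin n}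
    (x₀∈X₀ : X 0 x₀ ≡ true) (x∈X₃ : X 3 x ≡ true) (y∈X₃ : X 3 y ≡ true) (x≢y : x ≢ y) where

    X₀≗[x₀] : ∀ w → X 0 w ≡ inV (x₀ ∷ []) w
    X₀≗[x₀] = #V≡length⇒≗inV (X 0) ([] ∷ []) (x₀∈X₀ ∷ []) |X₀|≡1

    X₃≗[x,y] : ∀ w → X 3 w ≡ inV (x ∷ y ∷ []) w
    X₃≗[x,y] = #V≡length⇒≗inV (X 3) ((x≢y ∷ []) ∷ [] ∷ []) (x∈X₃ ∷ y∈X₃ ∷ []) |X₃|≡2

    a₀≡ : ∀ z → a 0 z ≡ χ (adj G z x₀)
    a₀≡ z = trans (∑-χ-≗inV (X 0) ([] ∷ []) X₀≗[x₀] (adj G z)) (countL-singleton (adj G z) x₀)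

    ∑-χ-X₃ : ∀ g → ∑[ w < n ] χ (X 3 w ∧ g w) ≡ χ (g x) + χ (g y)
    ∑-χ-X₃ g = trans (∑-χ-≗inV (X 3) ((x≢y ∷ []) ∷ [] ∷ []) X₃≗[x,y] g) (countL-pair g x y)

    x₀-outside : inV K x₀ ≡ false × nbrsIn G K x₀ ≡ 0
    x₀-outside = inX⇒∉×nbrsIn G K 0 x₀ x₀∈X₀

    x-outside : inV K x ≡ false × nbrsIn G K x ≡ 3
    x-outside = inX⇒∉×nbrsIn G K 3 x x∈X₃

    x₀≢x : x₀ ≢ x
    x₀≢x refl with trans (sym (proj₂ x₀-outside)) (proj₂ x-outside)
    ... | ()

    x₀-nbr∉K : ∀ {w} → adj G x₀ w ≡ true → inV K w ≡ false
    x₀-nbr∉K {w} x₀~w with inV K w in w∈K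
    ... | false = refl
    ... | true with trans (sym x₀~w) (All.lookup (countL≡0⇒All (adj G x₀) K (proj₂ x₀-outside)) (inV⇒∈ K w∈K))
    ...   | ()

    x₀-nbr∉X₀ : ∀ {w} → adj G x₀ w ≡ true → X 0 w ≡ false
    x₀-nbr∉X₀ {w} x₀~w with X 0 w in w∈X₀
    ... | false = refl
    ... | true with inV⇒∈ (x₀ ∷ []) (trans (sym (X₀≗[x₀] w)) w∈X₀)
    ...   | here refl with trans (sym x₀~w) (Graph.irrefl G x₀)
    ...     | ()

    χ-common-nbr-≤ : ∀ w → χ (adj G x₀ w ∧ adj G x w) ≤
      χ (X 1 w ∧ adj G x₀ w) + (χ (X 2 w ∧ (adj G x₀ w ∧ adj G x w)) + χ (X 3 w ∧ (adj G x₀ w ∧ adj G x w)))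
    χ-common-nbr-≤ w with adj G x₀ w in x₀~w | adj G x w
    ... | false | _ = z≤n
    ... | true | false = z≤n
    ... | true | true = χ-≤-X₁+X₂+X₃ (x₀-nbr∉K x₀~w) (x₀-nbr∉X₀ x₀~w) true

    a₃x≡ : a 3 x ≡ χ (adj G x y)
    a₃x≡ = trans (∑-χ-X₃ (adj G x)) (cong (λ b → χ b + χ (adj G x y)) (Graph.irrefl G x))

    a₁x₀≡ : a 1 x₀ ≡ χ (adj G x₀ x) + χ (adj G x₀ y)
    a₁x₀≡ = trans (a₁≡a₃-arith (proj₂ x₀-outside) (trans (a₀≡ x₀) (cong χ (Graph.irrefl G x₀)))
                    (profile (proj₁ x₀-outside)) (degree-profile x₀))
                  (∑-χ-X₃ (adj G x₀))

    -- Stated with inX G K rather than X: otherwise, at n = 95, matching it against lemma7 unfolds #V and is very slow.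
    nbrs-in-X₂⁻⁰-≤1 : #V (λ w → inX G K 2 w ∧ not (adj G x₀ w) ∧ adj G x w) ≤ 1
    nbrs-in-X₂⁻⁰-≤1 = subst (_≤ 1) (sym (#V≡∑ (λ w → X 2 w ∧ not (adj G x₀ w) ∧ adj G x w)))
      (c≤1-arith profile-x (srg-commonNbrs G srg refl x₀≢x) common-bound
        (χ≤1 (adj G x₀ x)) (χ≤1 (adj G x₀ y)) (χ-∧-≤ʳ (adj G x₀ y) (adj G x y)))
      where
        c z₂ : ℕ
        c = ∑[ w < n ] χ (X 2 w ∧ (not (adj G x₀ w) ∧ adj G x w))
        z₂ = ∑[ w < n ] χ (X 2 w ∧ (adj G x₀ w ∧ adj G x w))
        profile-x : c + z₂ + 2 * χ (adj G x y) + 30 ≡ 40 + χ (adj G x₀ x)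
        profile-x = begin
          c + z₂ + 2 * χ (adj G x y) + 30         ≡⟨ cong₂ (λ s t → s + 2 * t + 30) (sym (nbrsWith-split G (X 2) (adj G x₀) x)) (sym a₃x≡) ⟩
          a 2 x + 2 * a 3 x + 10 * 3               ≡⟨ cong (λ i → a 2 x + 2 * a 3 x + 10 * i) (proj₂ x-outside) ⟨
          a 2 x + 2 * a 3 x + 10 * nbrsIn G K x    ≡⟨ profile (proj₁ x-outside) ⟩
          40 + a 0 x                               ≡⟨ cong (40 +_) (trans (a₀≡ x) (cong χ (Graph.sym G x x₀))) ⟩
          40 + χ (adj G x₀ x)                      ∎
          where open ≡-Reasoning
        common-bound : commonNbrs G x₀ x ≤ (χ (adj G x₀ x) + χ (adj G x₀ y)) + (z₂ + χ (adj G x₀ y ∧ adj G x y))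
        common-bound = begin
          commonNbrs G x₀ x                                                  ≡⟨ #V≡∑ (λ w → adj G x₀ w ∧ adj G x w) ⟩
          ∑[ w < n ] χ (adj G x₀ w ∧ adj G x w)                              ≤⟨ sum-mono-≤ χ-common-nbr-≤ ⟩
          ∑[ w < n ] (χ-nbr G (X 1) x₀ w + (χ-X₂ w + χ-X₃ w))             ≡⟨ ∑-+ (χ-nbr G (X 1) x₀) a₁x₀≡ (∑-+ χ-X₂ refl z₃≡) ⟩
          (χ (adj G x₀ x) + χ (adj G x₀ y)) + (z₂ + χ (adj G x₀ y ∧ adj G x y)) ∎
          where
            open ≤-Reasoning
            χ-X₂ χ-X₃ : Fin n → ℕ
            χ-X₂ w = χ (X 2 w ∧ (adj G x₀ w ∧ adj G x w))
            χ-X₃ w = χ (X 3 w ∧ (adj G x₀ w ∧ adj G x w))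
            z₃≡ : ∑[ w < n ] χ-X₃ w ≡ χ (adj G x₀ y ∧ adj G x y)
            z₃≡ = trans (∑-χ-X₃ (λ w → adj G x₀ w ∧ adj G x w))
                    (cong (λ b → χ b + χ (adj G x₀ y ∧ adj G x y))
                      (trans (cong (adj G x₀ x ∧_) (Graph.irrefl G x)) (∧-zeroʳ (adj G x₀ x))))


lemma7 : (X : Graph 95) → IsSRG X 40 12 20 →
    (K : List (Fin 95)) → IsSClique X 4 K →
    (∀ (D : List (Fin 95)) → IsSClique X 5 D → ¬ (K ⊆V D)) →
    sizeX X K 0 ≡ 1 → sizeX X K 1 ≡ 34 → sizeX X K 2 ≡ 54 → sizeX X K 3 ≡ 2 →
    (x₀ x₁ x₂ : Fin 95) →
    inX X K 0 x₀ ≡ true → inX X K 3 x₁ ≡ true → inX X K 3 x₂ ≡ true → ¬ x₁ ≡ x₂ →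
    (#V (λ w → inX X K 2 w ∧ not (adj X x₀ w) ∧ adj X x₁ w) ≤ 1) ×
    (#V (λ w → inX X K 2 w ∧ not (adj X x₀ w) ∧ adj X x₂ w) ≤ 1)
lemma7 G srg K K-clique K-maximal |X₀|≡1 _ _ |X₃|≡2 x₀ x₁ x₂ x₀∈X₀ x₁∈X₃ x₂∈X₃ x₁≢x₂ =
  nbrs-in-X₂⁻⁰-≤1 |X₀|≡1 |X₃|≡2 x₀∈X₀ x₁∈X₃ x₂∈X₃ x₁≢x₂ ,
  nbrs-in-X₂⁻⁰-≤1 |X₀|≡1 |X₃|≡2 x₀∈X₀ x₂∈X₃ x₁∈X₃ (x₁≢x₂ ∘ sym)
  where open FourClique G srg K-clique K-maximal using (nbrs-in-X₂⁻⁰-≤1)
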